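{- For integers $t,s\ge 3$, \[ R^3(BK_t,BK_s)\le \max\{R^3(BK_{t-1},BK_s),\ R^3(BK_t,BK_{s-1})\}+1. \]
   Context: For a graph $G=(V,E)$ and an integer $r\ge 2$, $BG$ is the set of $r$-uniform hypergraphs $\mathcal{H}'$ for which there exist an injection $\phi: V\to V(\mathcal{H}')$ and a bijection $\psi: E\to E(\mathcal{H}')$ such that $\{\phi(u),\phi(v)\}\subseteq \psi(uv)$ for every edge $uv\in E$. $K_n$ denotes the complete graph on $n$ vertices. For collections $\mathcal{F}_1,\mathcal{F}_2$ of $r$-uniform hypergraphs, $R^r(\mathcal{F}_1,\mathcal{F}_2)$ is the least $N$ such that every 2-coloring of the hyperedges of the complete $r$-uniform hypergraph on $N$ vertices contains a subhypergraph of the first color isomorphic to a member of $\mathcal{F}_1$ or one of the second color isomorphic to a member of $\mathcal{F}_2$. Here $r=3$. -}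

module Defs where

open import Data.Nat using (ℕ; _≤_)
open import Data.Fin using (Fin; _<_)
open import Data.Product using (Σ; _×_; _,_)
open import Data.Sum using (_⊎_)
open import Data.Bool using (Bool; true; false)
open import Relation.Binary.PropositionalEquality using (_≡_)
open import Function.Definitions using (Injective)

-- A hyperedge of the complete 3-uniform hypergraph K_N^(3) on vertex set Fin N:
-- a 3-element subset {a,b,c}, represented canonically with a < b < c.
record Triple (N : ℕ) : Set where
  constructor triple
  field
    a b c : Fin N
    a<b : a < b
    b<c : b < c

_∈T_ : {N : ℕ} → Fin N → Triple N → Set
x ∈T e = (x ≡ Triple.a e) ⊎ ((x ≡ Triple.b e) ⊎ (x ≡ Triple.c e))

Pair : ℕ → Set
Pair t = Σ (Fin t × Fin t) (λ { (u , v) → u < v })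

Coloring : ℕ → Set
Coloring N = Triple N → Bool

-- The hyperedges of colour col contain a Berge-K_t, i.e. a subhypergraph isomorphic
-- to a member of BK_t: an injection φ of the vertices of K_t and an injective map ψ
-- (bijection onto its image) from the edges of K_t to hyperedges of colour col with
-- {φ u, φ v} ⊆ ψ(uv).
ContainsBK : {N : ℕ} → Coloring N → Bool → ℕ → Set
ContainsBK {N} χ col t =
  Σ (Fin t → Fin N) λ φ →
  Σ (Pair t → Triple N) λ ψ →
    Injective _≡_ _≡_ φ ×
    Injective _≡_ _≡_ ψ ×
    ((e : Pair t) → φ (Σ.proj₁ (Σ.proj₁ e)) ∈T ψ e × φ (Σ.proj₂ (Σ.proj₁ e)) ∈T ψ e) ×
    ((e : Pair t) → χ (ψ e) ≡ col)

Arrows : ℕ → ℕ → ℕ → Set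
Arrows t s N = (χ : Coloring N) → ContainsBK χ true t ⊎ ContainsBK χ false s

IsRamsey3 : ℕ → ℕ → ℕ → Set
IsRamsey3 t s N = Arrows t s N × ((M : ℕ) → Arrows t s M → N ≤ M)

-- Take N = max(a, b) + 1 vertices and single out the vertex 0. Restricted to
-- the remaining vertices, the colouring contains a first-colour BK_t or a
-- second-colour BK_s (done), or both a first-colour BK_{t-1} on vertex set C
-- and a second-colour BK_{s-1} on vertex set D. The link of 0 colours the
-- pairs {x, y} by the colour of {0, x, y}. The clique on C extends by 0 as
-- soon as every x ∈ C picks a neighbour G x with {x, G x} of the first colour
-- in the link, no two of these pairs coinciding. A greedy choice finds such
-- representatives unless some nonempty S ⊆ C has no first-colour link edge
-- leaving it; likewise for D with some T ⊆ D. Both obstructions cannot occur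
-- together: as neither C nor D contains all remaining vertices, one finds a
-- link edge leaving both S and T, which would have to carry both colours.
module Submission where

open import Defs
open import Data.Bool using (Bool; true; false)
open import Data.Bool.Properties using () renaming (_≟_ to _≟ᵇ_)
open import Data.Empty using (⊥; ⊥-elim)
open import Data.Fin using (Fin; zero; suc; _<_; inject≤)
open import Data.Fin.Properties
  using (<-cmp; <-irrefl; <-asym; <-irrelevant; suc-injective; toℕ-inject≤; injective⇒≤; any?; ¬∀⟶∃¬)
  renaming (_≟_ to _≟ᶠ_)
open import Data.List using (List; []; _∷_; tabulate; filter; length)
open import Data.List.Membership.Propositional using (_∈_; _∉_; find; lose)
open import Data.List.Membership.Propositional.Properties using (∈-tabulate⁺; ∈-tabulate⁻; ∈-filter⁺)
open import Data.List.Properties using (filter-notAll)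
open import Data.List.Relation.Binary.Subset.Propositional using (_⊆_)
open import Data.List.Relation.Binary.Subset.Propositional.Properties using (filter-⊆)
open import Data.List.Relation.Unary.Any using (here)
import Data.List.Relation.Unary.Any as Any
import Data.List.Membership.DecPropositional as DecMembership
open import Data.Nat using (ℕ; _≤_; _⊔_; _+_; _∸_; zero; suc; s≤s; z<s; s<s)
import Data.Nat as ℕ
open import Data.Nat.Properties using (≤-refl; ≤-trans; <-≤-trans; <⇒≱; n<1+n; m≤m⊔n; m≤n⊔m; +-comm)
open import Data.Product using (Σ; ∃; _×_; _,_; proj₁; proj₂)
open import Data.Sum using (_⊎_; inj₁; inj₂)
import Data.Sum as Sum
open import Data.Vec.Functional using (updateAt)
open import Data.Vec.Functional.Properties using (updateAt-updates; updateAt-minimal)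
open import Function using (_∘_; id; const)
open import Function.Definitions using (Injective)
open import Relation.Binary using (_Preserves_⟶_; tri<; tri≈; tri>)
open import Relation.Binary.PropositionalEquality using (_≡_; _≢_; refl; sym; trans; cong; cong₂; subst)
open import Relation.Nullary using (Dec; yes; no; ¬_; ¬?)
open import Relation.Nullary.Decidable using (_×-dec_)

Triple-≡ : ∀ {N} {a b c a′ b′ c′ : Fin N} {a<b b<c a′<b′ b′<c′} →
           a ≡ a′ → b ≡ b′ → c ≡ c′ → triple a b c a<b b<c ≡ triple a′ b′ c′ a′<b′ b′<c′
Triple-≡ refl refl refl = cong₂ (triple _ _ _) (<-irrelevant _ _) (<-irrelevant _ _)

Pair-≡ : ∀ {t} {u v u′ v′ : Fin t} {u<v : u < v} {u′<v′ : u′ < v′} →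
         u ≡ u′ → v ≡ v′ → _≡_ {A = Pair t} ((u , v) , u<v) ((u′ , v′) , u′<v′)
Pair-≡ {t} {u} {v} refl refl = cong {B = Pair t} (λ u<v → (u , v) , u<v) (<-irrelevant _ _)

module _ {A N : ℕ} (f : Fin A → Fin N) (f-mono : f Preserves _<_ ⟶ _<_) where

  <-preserving⇒injective : Injective _≡_ _≡_ f
  <-preserving⇒injective {x} {y} fx≡fy with <-cmp x y
  ... | tri< x<y _ _ = ⊥-elim (<-irrefl fx≡fy (f-mono x<y))
  ... | tri≈ _ x≡y _ = x≡y
  ... | tri> _ _ y<x = ⊥-elim (<-irrefl (sym fx≡fy) (f-mono y<x))

  mapTriple : Triple A → Triple N
  mapTriple (triple a b c a<b b<c) = triple (f a) (f b) (f c) (f-mono a<b) (f-mono b<c)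

  mapTriple-injective : Injective _≡_ _≡_ mapTriple
  mapTriple-injective eq =
    Triple-≡ (<-preserving⇒injective (cong Triple.a eq))
             (<-preserving⇒injective (cong Triple.b eq))
             (<-preserving⇒injective (cong Triple.c eq))

  ∈T-mapTriple : ∀ {x} T → x ∈T T → f x ∈T mapTriple T
  ∈T-mapTriple _ = Sum.map (cong f) (Sum.map (cong f) (cong f))

  ContainsBK-mapTriple : ∀ {χ : Coloring N} {col t} → ContainsBK (χ ∘ mapTriple) col t → ContainsBK χ col t
  ContainsBK-mapTriple (φ , ψ , φ-inj , ψ-inj , ends , colour) =
    f ∘ φ , mapTriple ∘ ψ , φ-inj ∘ <-preserving⇒injective , ψ-inj ∘ mapTriple-injective ,
    (λ e → ∈T-mapTriple (ψ e) (proj₁ (ends e)) , ∈T-mapTriple (ψ e) (proj₂ (ends e))) , colour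

ContainsBK⇒≤ : ∀ {N} {χ : Coloring N} {col t} → ContainsBK χ col t → t ≤ N
ContainsBK⇒≤ (_ , _ , φ-inj , _) = injective⇒≤ φ-inj

monochromatic-ContainsBK : ∀ {N k col col′} → ContainsBK {N} (const col) col′ (suc (suc k)) → col ≡ col′
monochromatic-ContainsBK (_ , _ , _ , _ , _ , colour) = colour ((zero , suc zero) , z<s)

Arrows⇒≤ʳ : ∀ {k s N} → Arrows (suc (suc k)) s N → s ≤ N
Arrows⇒≤ʳ arrows with arrows (const false)
... | inj₁ first  with () ← monochromatic-ContainsBK first
... | inj₂ second = ContainsBK⇒≤ second

Arrows⇒≤ˡ : ∀ {k t N} → Arrows t (suc (suc k)) N → t ≤ N
Arrows⇒≤ˡ arrows with arrows (const true)
... | inj₁ first  = ContainsBK⇒≤ first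
... | inj₂ second with () ← monochromatic-ContainsBK second

∃∉tabulate : ∀ {q n} (c : Fin q → Fin n) → q ℕ.< n → ∃ λ z → z ∉ tabulate c
∃∉tabulate {q} {n} c q<n = ¬∀⟶∃¬ n (_∈ tabulate c) (_∈? tabulate c) ¬covers
  where
  open DecMembership (_≟ᶠ_ {n}) using (_∈?_)
  ¬covers : ¬ (∀ z → z ∈ tabulate c)
  ¬covers covers = <⇒≱ q<n (injective⇒≤ index-injective)
    where
    index : Fin n → Fin q
    index z = proj₁ (∈-tabulate⁻ (covers z))
    index-injective : Injective _≡_ _≡_ index
    index-injective {z} {z′} eq =
      trans (proj₂ (∈-tabulate⁻ (covers z)))
            (trans (cong c eq) (sym (proj₂ (∈-tabulate⁻ (covers z′)))))

module ColouredGraph {n : ℕ} (κ : Fin n → Fin n → Bool) where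

  open DecMembership (_≟ᶠ_ {n}) using (_∈?_)

  -- The pairs {x, G x} for x ∈ L are pairwise distinct and never degenerate.
  SwapFree : (Fin n → Fin n) → List (Fin n) → Set
  SwapFree G L = ∀ {x y} → x ∈ L → y ∈ L → G x ≡ y → G y ≡ x → ⊥

  Representatives : Bool → List (Fin n) → Set
  Representatives col L = Σ (Fin n → Fin n) λ G → (∀ {x} → x ∈ L → κ x (G x) ≡ col) × SwapFree G L

  Closed : Bool → List (Fin n) → Set
  Closed col L =
    Σ (List (Fin n)) λ S → S ⊆ L × (∃ λ x → x ∈ S) × (∀ {x y} → x ∈ S → y ∉ S → κ x y ≢ col)

  Closed-⊆ : ∀ {col L M} → L ⊆ M → Closed col L → Closed col M
  Closed-⊆ L⊆M (S , S⊆L , inhabited , closed) = S , L⊆M ∘ S⊆L , inhabited , closed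

  Escapes : Bool → List (Fin n) → Fin n → Set
  Escapes col L x = ∃ λ w → w ∉ L × κ x w ≡ col

  escapes? : ∀ col L x → Dec (Escapes col L x)
  escapes? col L x = any? (λ w → ¬? (w ∈? L) ×-dec (κ x w ≟ᵇ col))

  ≢? : (x y : Fin n) → Dec (y ≢ x)
  ≢? x = ¬? ∘ (_≟ᶠ x)

  without : Fin n → List (Fin n) → List (Fin n)
  without x = filter (≢? x)

  length-without : ∀ {x L} → x ∈ L → length (without x L) ℕ.< length L
  length-without {x} {L} x∈L = filter-notAll (≢? x) L (Any.map (λ y≡x y≢x → y≢x (sym y≡x)) x∈L)

  Representatives-insert : ∀ {col L x w} → w ∉ L → κ x w ≡ col →
                           Representatives col (without x L) → Representatives col L
  Representatives-insert {col} {L} {x} {w} w∉L κxw (G , colour , swapFree) =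
    G′ , colour′ , swapFree′
    where
    G′ : Fin n → Fin n
    G′ = updateAt G x (const w)
    G′-x : G′ x ≡ w
    G′-x = updateAt-updates x G
    G′-y : ∀ {y} → y ≢ x → G′ y ≡ G y
    G′-y {y} y≢x = updateAt-minimal y x G y≢x
    colour′ : ∀ {y} → y ∈ L → κ y (G′ y) ≡ col
    colour′ {y} y∈L with y ≟ᶠ x
    ... | yes refl = trans (cong (κ x) G′-x) κxw
    ... | no y≢x   = trans (cong (κ y) (G′-y y≢x)) (colour (∈-filter⁺ (≢? x) y∈L y≢x))
    swapFree′ : SwapFree G′ L
    swapFree′ {y} {z} y∈L z∈L G′y≡z G′z≡y with y ≟ᶠ x | z ≟ᶠ x
    ... | yes refl | _        = w∉L (subst (_∈ L) (trans (sym G′y≡z) G′-x) z∈L)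
    ... | no _     | yes refl = w∉L (subst (_∈ L) (trans (sym G′z≡y) G′-x) y∈L)
    ... | no y≢x   | no z≢x   = swapFree (∈-filter⁺ (≢? x) y∈L y≢x) (∈-filter⁺ (≢? x) z∈L z≢x)
                                  (trans (sym (G′-y y≢x)) G′y≡z) (trans (sym (G′-y z≢x)) G′z≡y)

  -- Greedily, a vertex with a col-neighbour outside L takes it as its
  -- representative and leaves L; if no vertex can, L itself is closed.
  Representatives⊎Closed : ∀ col L → Representatives col L ⊎ Closed col L
  Representatives⊎Closed col L = greedy (length L) L ≤-refl
    where
    greedy : ∀ k L → length L ≤ k → Representatives col L ⊎ Closed col L
    greedy _       []      _ = inj₁ (id , (λ ()) , (λ ()))
    greedy (suc k) L@(x₀ ∷ _) (s≤s |L|≤k) with Any.any? (escapes? col L) L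
    ... | no stuck =
      inj₂ (L , id , (x₀ , here refl) , λ x∈L y∉L κxy → stuck (lose x∈L (_ , y∉L , κxy)))
    ... | yes escaping with find escaping
    ...   | x , x∈L , w , w∉L , κxw =
      Sum.map (Representatives-insert w∉L κxw) (Closed-⊆ (filter-⊆ (≢? x) L))
        (greedy k (without x L) (≤-trans (ℕ.s≤s⁻¹ (length-without x∈L)) |L|≤k))

  -- With S closed for true, T closed for false, w ∉ S and z ∉ T: S ⊆ T, since
  -- otherwise some edge goes from S ∖ T to T ∖ S or leaves both S and T; hence
  -- z ∉ S too, and an edge from S ∩ T to z leaves both.
  ¬Closed×Closed : (∀ {x y} → x ≢ y → κ x y ≡ κ y x) → ∀ {L M} →
                   Closed true L → Closed false M → ∃ (_∉ L) → ∃ (_∉ M) → ⊥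
  ¬Closed×Closed κ-sym (S , S⊆L , (x₀ , x₀∈S) , S-closed) (T , T⊆M , (y₀ , y₀∈T) , T-closed)
                 (w , w∉L) (z , z∉M) = z-outside
    where
    w∉S : w ∉ S
    w∉S = w∉L ∘ S⊆L
    z∉T : z ∉ T
    z∉T = z∉M ∘ T⊆M
    leaves-both : ∀ {p q} → p ∈ S → p ∈ T → q ∉ S → q ∉ T → ⊥
    leaves-both {p} {q} p∈S p∈T q∉S q∉T with κ p q in κpq
    ... | true  = S-closed p∈S q∉S κpq
    ... | false = T-closed p∈T q∉T κpq
    crosses : ∀ {p q} → p ∈ S → p ∉ T → q ∉ S → q ∈ T → ⊥
    crosses {p} {q} p∈S p∉T q∉S q∈T with κ p q in κpq
    ... | true  = S-closed p∈S q∉S κpq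
    ... | false = T-closed q∈T p∉T (trans (κ-sym λ { refl → p∉T q∈T }) κpq)
    S⊆T : ∀ {p} → p ∈ S → p ∉ T → ⊥
    S⊆T p∈S p∉T with y₀ ∈? S | w ∈? T
    ... | no y₀∉S | _       = crosses p∈S p∉T y₀∉S y₀∈T
    ... | yes _   | yes w∈T = crosses p∈S p∉T w∉S w∈T
    ... | yes y₀∈S | no w∉T = leaves-both y₀∈S y₀∈T w∉S w∉T
    z-outside : ⊥
    z-outside with x₀ ∈? T | z ∈? S
    ... | no x₀∉T | _        = S⊆T x₀∈S x₀∉T
    ... | yes _   | yes z∈S  = S⊆T z∈S z∉T
    ... | yes x₀∈T | no z∉S  = leaves-both x₀∈S x₀∈T z∉S z∉T

inject≤-mono : ∀ {m n} (m≤n : m ≤ n) → (λ i → inject≤ i m≤n) Preserves _<_ ⟶ _<_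
inject≤-mono m≤n {i} {j} i<j rewrite toℕ-inject≤ i m≤n | toℕ-inject≤ j m≤n = i<j

module Link {n : ℕ} (χ : Coloring (suc n)) where

  χ⁺ : Coloring n
  χ⁺ = χ ∘ mapTriple suc s<s

  cone : (x y : Fin n) → x ≢ y → Triple (suc n)
  cone x y x≢y with <-cmp x y
  ... | tri< x<y _ _ = triple zero (suc x) (suc y) z<s (s<s x<y)
  ... | tri≈ _ x≡y _ = ⊥-elim (x≢y x≡y)
  ... | tri> _ _ y<x = triple zero (suc y) (suc x) z<s (s<s y<x)

  -- The value on the diagonal is irrelevant.
  κ : Fin n → Fin n → Bool
  κ x y with <-cmp x y
  ... | tri< x<y _ _ = χ (triple zero (suc x) (suc y) z<s (s<s x<y))
  ... | tri≈ _ _ _   = true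
  ... | tri> _ _ y<x = χ (triple zero (suc y) (suc x) z<s (s<s y<x))

  κ≡χ-cone : ∀ {x y} (x≢y : x ≢ y) → κ x y ≡ χ (cone x y x≢y)
  κ≡χ-cone {x} {y} x≢y with <-cmp x y
  ... | tri< _ _ _   = refl
  ... | tri≈ _ x≡y _ = ⊥-elim (x≢y x≡y)
  ... | tri> _ _ _   = refl

  κ-sym : ∀ {x y} → x ≢ y → κ x y ≡ κ y x
  κ-sym {x} {y} x≢y with <-cmp x y | <-cmp y x
  ... | tri< _ _ _   | tri> _ _ _   = cong χ (Triple-≡ refl refl refl)
  ... | tri> _ _ _   | tri< _ _ _   = cong χ (Triple-≡ refl refl refl)
  ... | tri< x<y _ _ | tri< y<x _ _ = ⊥-elim (<-asym x<y y<x)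
  ... | tri> _ _ y<x | tri> _ _ x<y = ⊥-elim (<-asym x<y y<x)
  ... | tri≈ _ x≡y _ | _            = ⊥-elim (x≢y x≡y)
  ... | _            | tri≈ _ y≡x _ = ⊥-elim (x≢y (sym y≡x))

  zero∈cone : ∀ {x y} (x≢y : x ≢ y) → zero ∈T cone x y x≢y
  zero∈cone {x} {y} x≢y with <-cmp x y
  ... | tri< _ _ _   = inj₁ refl
  ... | tri≈ _ x≡y _ = ⊥-elim (x≢y x≡y)
  ... | tri> _ _ _   = inj₁ refl

  suc∈cone : ∀ {x y} (x≢y : x ≢ y) → suc x ∈T cone x y x≢y
  suc∈cone {x} {y} x≢y with <-cmp x y
  ... | tri< _ _ _   = inj₂ (inj₁ refl)
  ... | tri≈ _ x≡y _ = ⊥-elim (x≢y x≡y)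
  ... | tri> _ _ _   = inj₂ (inj₂ refl)

  ∈cone⁻ : ∀ {w x y} (x≢y : x ≢ y) → w ∈T cone x y x≢y → w ≡ zero ⊎ w ≡ suc x ⊎ w ≡ suc y
  ∈cone⁻ {x = x} {y} x≢y w∈ with <-cmp x y
  ... | tri< _ _ _   = w∈
  ... | tri≈ _ x≡y _ = ⊥-elim (x≢y x≡y)
  ... | tri> _ _ _   = Sum.map₂ Sum.swap w∈

  zero∉mapTriple-suc : (T : Triple n) → ¬ zero ∈T mapTriple suc s<s T
  zero∉mapTriple-suc _ (inj₁ ())
  zero∉mapTriple-suc _ (inj₂ (inj₁ ()))
  zero∉mapTriple-suc _ (inj₂ (inj₂ ()))

  open ColouredGraph κ

  module Spokes {p} {c : Fin p → Fin n} (c-inj : Injective _≡_ _≡_ c)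
                {G : Fin n → Fin n} (swapFree : SwapFree G (tabulate c)) where

    c∈ : ∀ i → c i ∈ tabulate c
    c∈ = ∈-tabulate⁺

    c≢G : ∀ i → c i ≢ G (c i)
    c≢G i eq = swapFree (c∈ i) (c∈ i) (sym eq) (sym eq)

    spoke : Fin p → Triple (suc n)
    spoke i = cone (c i) (G (c i)) (c≢G i)

    spoke-hits : ∀ {i j} → spoke i ≡ spoke j → i ≢ j → c i ≡ G (c j)
    spoke-hits {i} {j} eq i≢j with ∈cone⁻ (c≢G j) (subst (suc (c i) ∈T_) eq (suc∈cone (c≢G i)))
    ... | inj₂ (inj₁ eq′) = ⊥-elim (i≢j (c-inj (suc-injective eq′)))
    ... | inj₂ (inj₂ eq′) = suc-injective eq′

    spoke-injective : Injective _≡_ _≡_ spoke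
    spoke-injective {i} {j} eq with i ≟ᶠ j
    ... | yes i≡j = i≡j
    ... | no i≢j  =
      ⊥-elim (swapFree (c∈ i) (c∈ j) (sym (spoke-hits (sym eq) (i≢j ∘ sym))) (sym (spoke-hits eq i≢j)))

    spoke≢lift : ∀ j T → spoke j ≢ mapTriple suc s<s T
    spoke≢lift j T eq = zero∉mapTriple-suc T (subst (zero ∈T_) eq (zero∈cone (c≢G j)))

  extend : ∀ {col p} (K : ContainsBK χ⁺ col p) → Representatives col (tabulate (proj₁ K)) →
           ContainsBK χ col (suc p)
  extend {col} {p} (c , ψ , c-inj , ψ-inj , ends , colour) (G , G-colour , swapFree) =
    φ′ , ψ′ , φ′-inj , ψ′-inj , ends′ , colour′
    where
    open Spokes c-inj swapFree
    φ′ : Fin (suc p) → Fin (suc n)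
    φ′ zero    = zero
    φ′ (suc i) = suc (c i)
    ψ′ : Pair (suc p) → Triple (suc n)
    ψ′ ((zero , suc j) , _)       = spoke j
    ψ′ ((suc i , suc j) , s<s i<j) = mapTriple suc s<s (ψ ((i , j) , i<j))
    φ′-inj : Injective _≡_ _≡_ φ′
    φ′-inj {zero}  {zero}  _  = refl
    φ′-inj {suc i} {suc j} eq = cong suc (c-inj (suc-injective eq))
    ψ′-inj : Injective _≡_ _≡_ ψ′
    ψ′-inj {(zero , suc _) , _} {(zero , suc _) , _} eq = Pair-≡ refl (cong suc (spoke-injective eq))
    ψ′-inj {(zero , suc j) , _} {(suc _ , suc _) , s<s _} eq = ⊥-elim (spoke≢lift j _ eq)
    ψ′-inj {(suc _ , suc _) , s<s _} {(zero , suc j) , _} eq = ⊥-elim (spoke≢lift j _ (sym eq))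
    ψ′-inj {(suc _ , suc _) , s<s _} {(suc _ , suc _) , s<s _} eq
      with refl ← ψ-inj (mapTriple-injective suc s<s eq) = refl
    ends′ : (e : Pair (suc p)) → φ′ (proj₁ (proj₁ e)) ∈T ψ′ e × φ′ (proj₂ (proj₁ e)) ∈T ψ′ e
    ends′ ((zero , suc j) , _) = zero∈cone (c≢G j) , suc∈cone (c≢G j)
    ends′ ((suc i , suc j) , s<s i<j) =
      let T = ψ ((i , j) , i<j) in
      ∈T-mapTriple suc s<s T (proj₁ (ends _)) , ∈T-mapTriple suc s<s T (proj₂ (ends _))
    colour′ : (e : Pair (suc p)) → χ (ψ′ e) ≡ col
    colour′ ((zero , suc j) , _)       = trans (sym (κ≡χ-cone (c≢G j))) (G-colour (c∈ j))
    colour′ ((suc i , suc j) , s<s i<j) = colour ((i , j) , i<j)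

  extend⊎extend : ∀ {p q} (K : ContainsBK χ⁺ true p) (L : ContainsBK χ⁺ false q) → p ℕ.< n → q ℕ.< n →
                  ContainsBK χ true (suc p) ⊎ ContainsBK χ false (suc q)
  extend⊎extend K L p<n q<n
    with Representatives⊎Closed true (tabulate (proj₁ K)) | Representatives⊎Closed false (tabulate (proj₁ L))
  ... | inj₁ reps    | _           = inj₁ (extend K reps)
  ... | inj₂ _       | inj₁ reps   = inj₂ (extend L reps)
  ... | inj₂ closedᴷ | inj₂ closedᴸ =
    ⊥-elim (¬Closed×Closed κ-sym closedᴷ closedᴸ (∃∉tabulate _ p<n) (∃∉tabulate _ q<n))

  χ↾ : ∀ {A} → A ≤ n → Coloring A
  χ↾ A≤n = χ⁺ ∘ mapTriple _ (inject≤-mono A≤n)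

  ContainsBK-χ↾ : ∀ {A col k} (A≤n : A ≤ n) → ContainsBK (χ↾ A≤n) col k → ContainsBK χ⁺ col k
  ContainsBK-χ↾ A≤n = ContainsBK-mapTriple _ (inject≤-mono A≤n) {χ⁺}

  ContainsBK-χ⁺ : ∀ {col k} → ContainsBK χ⁺ col k → ContainsBK χ col k
  ContainsBK-χ⁺ = ContainsBK-mapTriple suc s<s {χ}

  arrows-step : ∀ {t s a b} →
                Arrows (suc (suc t)) (suc (suc (suc s))) a → Arrows (suc (suc (suc t))) (suc (suc s)) b →
                a ≤ n → b ≤ n → ContainsBK χ true (suc (suc (suc t))) ⊎ ContainsBK χ false (suc (suc (suc s)))
  arrows-step arrowsᵃ arrowsᵇ a≤n b≤n with arrowsᵃ (χ↾ a≤n) | arrowsᵇ (χ↾ b≤n)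
  ... | inj₂ second | _           = inj₂ (ContainsBK-χ⁺ (ContainsBK-χ↾ a≤n second))
  ... | inj₁ _      | inj₁ first  = inj₁ (ContainsBK-χ⁺ (ContainsBK-χ↾ b≤n first))
  ... | inj₁ first  | inj₂ second =
    extend⊎extend (ContainsBK-χ↾ a≤n first) (ContainsBK-χ↾ b≤n second)
      (<-≤-trans (n<1+n _) (≤-trans (Arrows⇒≤ˡ arrowsᵇ) b≤n))
      (<-≤-trans (n<1+n _) (≤-trans (Arrows⇒≤ʳ arrowsᵃ) a≤n))

lemma2p4 : (t s : ℕ) → 3 ≤ t → 3 ≤ s →
    (a b c : ℕ) →
    IsRamsey3 (t ∸ 1) s a → IsRamsey3 t (s ∸ 1) b → IsRamsey3 t s c →
    c ≤ (a ⊔ b) + 1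
lemma2p4 (suc (suc (suc t))) (suc (suc (suc s))) (s≤s (s≤s (s≤s _))) (s≤s (s≤s (s≤s _)))
         a b c (arrowsᵃ , _) (arrowsᵇ , _) (_ , minimal) =
  minimal (a ⊔ b + 1) (subst (Arrows _ _) (+-comm 1 (a ⊔ b))
    (λ χ → Link.arrows-step χ arrowsᵃ arrowsᵇ (m≤m⊔n a b) (m≤n⊔m a b)))
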